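{- For every integer $k\ge 1$, $$(1-x)^2(1-x^2)^{2k-1}\sum_{n\ge 0}\binom{\lfloor (n+2k)/2\rfloor}{k}\binom{\lfloor (n+1+2k)/2\rfloor}{k}x^n=r_{k-1}(x),$$ where for $j\ge 0$ $$r_j(x)=\sum_{\ell=0}^{j}\binom{j}{\ell}^2x^{2\ell}+\sum_{\ell=1}^{j}\binom{j}{\ell}\binom{j}{\ell-1}x^{2\ell-1}.$$
   Context: Identity of formal power series in $x$. -}

module Defs where

open import Data.Nat as ℕ using (ℕ; zero; suc; _∸_; _/_)
open import Data.Nat.Combinatorics using (_C_)
open import Relation.Nullary using (yes; no)
open import Data.Integer as ℤ using (ℤ; +_; -_; _+_; _*_)

-- Formal power series in x over ℤ, represented by their coefficient sequence:
-- a series f stands for  Σ_{n≥0} f n · xⁿ.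
Series : Set
Series = ℕ → ℤ

sumBelow : ℕ → (ℕ → ℤ) → ℤ
sumBelow zero    f = + 0
sumBelow (suc n) f = sumBelow n f + f n

_⊕_ : Series → Series → Series
(f ⊕ g) n = f n + g n

_⊛_ : Series → Series → Series
(f ⊛ g) n = sumBelow (suc n) (λ i → f i * g (n ∸ i))

one : Series
one zero    = + 1
one (suc _) = + 0

_^ˢ_ : Series → ℕ → Series
f ^ˢ zero  = one
f ^ˢ suc m = f ⊛ (f ^ˢ m)

mono : ℤ → ℕ → Series
mono c e n with n ℕ.≟ e
... | yes _ = c
... | no  _ = + 0

-- finite sum of series  Σ_{ℓ=a}^{b} F ℓ  (empty if b < a)
sumRange : ℕ → ℕ → (ℕ → Series) → Series
sumRange a b F n = sumBelow (suc b ∸ a) (λ i → F (a ℕ.+ i) n)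

oneMinusX : Series
oneMinusX = one ⊕ mono (- (+ 1)) 1

oneMinusX² : Series
oneMinusX² = one ⊕ mono (- (+ 1)) 2

F : ℕ → Series
F k n = + ((((n ℕ.+ 2 ℕ.* k) / 2) C k) ℕ.* (((n ℕ.+ 1 ℕ.+ 2 ℕ.* k) / 2) C k))

r : ℕ → Series
r j = sumRange 0 j (λ ℓ → mono (+ ((j C ℓ) ℕ.* (j C ℓ))) (2 ℕ.* ℓ))
    ⊕ sumRange 1 j (λ ℓ → mono (+ ((j C ℓ) ℕ.* (j C (ℓ ∸ 1)))) (2 ℕ.* ℓ ∸ 1))

-- Write a series as E(x²) + x·O(x²), with even part E and odd part O. The even and odd parts
-- of F_k are C(m+k,k)² and C(m+k,k) C(m+k+1,k), and the identity
--   C(m+a,a) C(m+b,b) = Σ_j C(a,j) C(b,j) C(m-j+a+b, a+b)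
-- together with a shifted companion writes them as P(y)/(1-y)^(2k+1) and Q(y)/(1-y)^(2k+1), where
-- P(y) = Σ_j C(k,j)² y^j and Q(y) = Σ_j C(k-1,j) C(k+1,j+1) y^j. Multiplication by 1 - x² acts on
-- both parts as multiplication by 1 - y, so (1-x²)^(2k+1) F_k = P(x²) + x Q(x²), and Pascal's rule
-- gives P(x²) + x Q(x²) = (1+x)² r_{k-1}(x). As (1+x)²(1-x)² = (1-x²)² and multiplication by 1 + x
-- is injective, the theorem follows.

module Submission where

open import Data.Nat as ℕ using (ℕ; zero; suc; _∸_; _≤_; _<_; _≥_; z≤n; s≤s)
import Data.Nat.Properties as ℕₚ
open import Data.Nat.Combinatorics using (_C_; nCn≡1; nCk≡nC[n∸k]; nCk+nC[k+1]≡[n+1]C[k+1]; k>n⇒nCk≡0)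
open import Data.Nat.DivMod using (_/_; m*n/n≡m; +-distrib-/-∣ʳ)
open import Data.Nat.Divisibility using (divides)
open import Data.Nat.Tactic.RingSolver using () renaming (solve to ℕ-solve)
open import Data.Integer using (ℤ; +_; -_; _+_; _*_; _-_)
open import Data.Integer.Properties
open import Data.Integer.Tactic.RingSolver using (solve-∀)
open import Data.List using (_∷_; [])
open import Function using (_∘_)
open import Relation.Binary.PropositionalEquality
open import Relation.Nullary using (yes; no; contradiction)
open ≡-Reasoning

open import Defs

sumBelow-cong : ∀ n {f g : ℕ → ℤ} → f ≗ g → sumBelow n f ≡ sumBelow n g
sumBelow-cong zero    f≗g = refl
sumBelow-cong (suc n) f≗g = cong₂ _+_ (sumBelow-cong n f≗g) (f≗g n)

sumBelow-zero : ∀ n {f : ℕ → ℤ} → (∀ i → i < n → f i ≡ + 0) → sumBelow n f ≡ + 0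
sumBelow-zero zero    f≡0 = refl
sumBelow-zero (suc n) f≡0 =
  cong₂ _+_ (sumBelow-zero n (λ i i<n → f≡0 i (ℕₚ.m<n⇒m<1+n i<n))) (f≡0 n (ℕₚ.n<1+n n))

sumBelow-+ : ∀ n (f g : ℕ → ℤ) → sumBelow n (λ i → f i + g i) ≡ sumBelow n f + sumBelow n g
sumBelow-+ zero    f g = refl
sumBelow-+ (suc n) f g =
  trans (cong (_+ (f n + g n)) (sumBelow-+ n f g)) (+-interchange (sumBelow n f) (sumBelow n g) (f n) (g n))
  where
  +-interchange : ∀ a b c d → a + b + (c + d) ≡ a + c + (b + d)
  +-interchange = solve-∀

sumBelow-*ˡ : ∀ n c (f : ℕ → ℤ) → sumBelow n (λ i → c * f i) ≡ c * sumBelow n f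
sumBelow-*ˡ zero    c f = sym (*-zeroʳ c)
sumBelow-*ˡ (suc n) c f =
  trans (cong (_+ c * f n) (sumBelow-*ˡ n c f)) (sym (*-distribˡ-+ c (sumBelow n f) (f n)))

sumBelow-suc : ∀ n (f : ℕ → ℤ) → sumBelow (suc n) f ≡ f 0 + sumBelow n (λ i → f (suc i))
sumBelow-suc zero    f = +-comm (+ 0) (f 0)
sumBelow-suc (suc n) f = trans (cong (_+ f (suc n)) (sumBelow-suc n f)) (+-assoc (f 0) _ _)

tail : Series → Series
tail f n = f (suc n)

infix 30 x·_
x·_ : Series → Series
(x· f) zero    = + 0
(x· f) (suc n) = f n

⊛-suc : ∀ f g n → (f ⊛ g) (suc n) ≡ f 0 * g (suc n) + (tail f ⊛ g) n
⊛-suc f g n = sumBelow-suc (suc n) _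

⊛-congˡ : ∀ {f f′} g → f ≗ f′ → f ⊛ g ≗ f′ ⊛ g
⊛-congˡ g f≗f′ n = sumBelow-cong (suc n) (λ i → cong (_* g (n ∸ i)) (f≗f′ i))

⊛-congʳ : ∀ f {g g′} → g ≗ g′ → f ⊛ g ≗ f ⊛ g′
⊛-congʳ f g≗g′ n = sumBelow-cong (suc n) (λ i → cong (f i *_) (g≗g′ (n ∸ i)))

⊛-identityˡ : ∀ g → one ⊛ g ≗ g
⊛-identityˡ g zero    = trans (+-identityˡ _) (*-identityˡ (g 0))
⊛-identityˡ g (suc n) = begin
  (one ⊛ g) (suc n)
    ≡⟨ ⊛-suc one g n ⟩
  + 1 * g (suc n) + (tail one ⊛ g) n
    ≡⟨ cong₂ _+_ (*-identityˡ (g (suc n))) (sumBelow-zero (suc n) (λ _ _ → refl)) ⟩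
  g (suc n) + + 0
    ≡⟨ +-identityʳ (g (suc n)) ⟩
  g (suc n) ∎

⊛-identityʳ : ∀ f → f ⊛ one ≗ f
⊛-identityʳ f zero    = trans (+-identityˡ _) (*-identityʳ (f 0))
⊛-identityʳ f (suc n) = begin
  (f ⊛ one) (suc n)            ≡⟨ ⊛-suc f one n ⟩
  f 0 * + 0 + (tail f ⊛ one) n ≡⟨ cong₂ _+_ (*-zeroʳ (f 0)) (⊛-identityʳ (tail f) n) ⟩
  + 0 + f (suc n)              ≡⟨ +-identityˡ (f (suc n)) ⟩
  f (suc n)                    ∎

⊕-⊛ : ∀ f g h → (f ⊕ g) ⊛ h ≗ (f ⊛ h) ⊕ (g ⊛ h)
⊕-⊛ f g h n = trans (sumBelow-cong (suc n) (λ i → *-distribʳ-+ (h (n ∸ i)) (f i) (g i)))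
                    (sumBelow-+ (suc n) _ _)

x·-⊛ : ∀ f g n → ((x· f) ⊛ g) (suc n) ≡ (f ⊛ g) n
x·-⊛ f g n = trans (⊛-suc (x· f) g n) (+-identityˡ _)

⊛-constant : ∀ s g → (∀ n → s (suc n) ≡ + 0) → ∀ n → (s ⊛ g) n ≡ s 0 * g n
⊛-constant s g s₊≡0 zero    = +-identityˡ _
⊛-constant s g s₊≡0 (suc n) = begin
  (s ⊛ g) (suc n)
    ≡⟨ ⊛-suc s g n ⟩
  s 0 * g (suc n) + (tail s ⊛ g) n
    ≡⟨ cong (_+_ (s 0 * g (suc n))) (sumBelow-zero (suc n) (λ i _ → cong (_* g (n ∸ i)) (s₊≡0 i))) ⟩
  s 0 * g (suc n) + + 0
    ≡⟨ +-identityʳ _ ⟩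
  s 0 * g (suc n) ∎

⊛-assoc : ∀ f g h → (f ⊛ g) ⊛ h ≗ f ⊛ (g ⊛ h)
⊛-assoc f g h zero    = base (f 0) (g 0) (h 0)
  where
  base : ∀ a b c → + 0 + (+ 0 + a * b) * c ≡ + 0 + a * (+ 0 + b * c)
  base = solve-∀
⊛-assoc f g h (suc n) = begin
  ((f ⊛ g) ⊛ h) (suc n)
    ≡⟨ ⊛-suc (f ⊛ g) h n ⟩
  (+ 0 + f 0 * g 0) * h (suc n) + (tail (f ⊛ g) ⊛ h) n
    ≡⟨ cong (_+_ ((+ 0 + f 0 * g 0) * h (suc n))) (⊛-tail-⊛ n) ⟩
  (+ 0 + f 0 * g 0) * h (suc n) + (f 0 * (tail g ⊛ h) n + ((tail f ⊛ g) ⊛ h) n)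
    ≡⟨ regroup (f 0) (g 0) (h (suc n)) ((tail g ⊛ h) n) (((tail f ⊛ g) ⊛ h) n) ⟩
  f 0 * (g 0 * h (suc n) + (tail g ⊛ h) n) + ((tail f ⊛ g) ⊛ h) n
    ≡⟨ cong₂ (λ u v → f 0 * u + v) (sym (⊛-suc g h n)) (⊛-assoc (tail f) g h n) ⟩
  f 0 * (g ⊛ h) (suc n) + (tail f ⊛ (g ⊛ h)) n
    ≡⟨ sym (⊛-suc f (g ⊛ h) n) ⟩
  (f ⊛ (g ⊛ h)) (suc n) ∎
  where
  regroup : ∀ a b c X Y → (+ 0 + a * b) * c + (a * X + Y) ≡ a * (b * c + X) + Y
  regroup = solve-∀
  ⊛-tail-⊛ : ∀ n → (tail (f ⊛ g) ⊛ h) n ≡ f 0 * (tail g ⊛ h) n + ((tail f ⊛ g) ⊛ h) n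
  ⊛-tail-⊛ n = begin
    sumBelow (suc n) (λ i → (f ⊛ g) (suc i) * h (n ∸ i))
      ≡⟨ sumBelow-cong (suc n) (λ i → begin
           (f ⊛ g) (suc i) * h (n ∸ i)
             ≡⟨ cong (_* h (n ∸ i)) (⊛-suc f g i) ⟩
           (f 0 * g (suc i) + (tail f ⊛ g) i) * h (n ∸ i)
             ≡⟨ *-distribʳ-+ (h (n ∸ i)) (f 0 * g (suc i)) ((tail f ⊛ g) i) ⟩
           f 0 * g (suc i) * h (n ∸ i) + (tail f ⊛ g) i * h (n ∸ i)
             ≡⟨ cong (_+ (tail f ⊛ g) i * h (n ∸ i)) (*-assoc (f 0) (g (suc i)) (h (n ∸ i))) ⟩
           f 0 * (g (suc i) * h (n ∸ i)) + (tail f ⊛ g) i * h (n ∸ i) ∎) ⟩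
    sumBelow (suc n) (λ i → f 0 * (g (suc i) * h (n ∸ i)) + (tail f ⊛ g) i * h (n ∸ i))
      ≡⟨ sumBelow-+ (suc n) _ _ ⟩
    sumBelow (suc n) (λ i → f 0 * (g (suc i) * h (n ∸ i))) + ((tail f ⊛ g) ⊛ h) n
      ≡⟨ cong (_+ ((tail f ⊛ g) ⊛ h) n) (sumBelow-*ˡ (suc n) (f 0) _) ⟩
    f 0 * (tail g ⊛ h) n + ((tail f ⊛ g) ⊛ h) n ∎

infix 30 [1-x]·_
[1-x]·_ : Series → Series
([1-x]· g) zero    = g 0
([1-x]· g) (suc n) = g (suc n) - g n

infix 30 [1-x²]·_
[1-x²]·_ : Series → Series
([1-x²]· g) zero          = g 0
([1-x²]· g) (suc zero)    = g 1
([1-x²]· g) (suc (suc n)) = g (suc (suc n)) - g n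

infix 30 [1+x]·_
[1+x]·_ : Series → Series
([1+x]· g) zero    = g 0
([1+x]· g) (suc n) = g (suc n) + g n

[1-x]-cong : ∀ {g h} → g ≗ h → [1-x]· g ≗ [1-x]· h
[1-x]-cong g≗h zero    = g≗h 0
[1-x]-cong g≗h (suc n) = cong₂ _-_ (g≗h (suc n)) (g≗h n)

[1-x²]-cong : ∀ {g h} → g ≗ h → [1-x²]· g ≗ [1-x²]· h
[1-x²]-cong g≗h zero          = g≗h 0
[1-x²]-cong g≗h (suc zero)    = g≗h 1
[1-x²]-cong g≗h (suc (suc n)) = cong₂ _-_ (g≗h (suc (suc n))) (g≗h n)

[1+x]-cong : ∀ {g h} → g ≗ h → [1+x]· g ≗ [1+x]· h
[1+x]-cong g≗h zero    = g≗h 0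
[1+x]-cong g≗h (suc n) = cong₂ _+_ (g≗h (suc n)) (g≗h n)

oneMinusX-⊛ : ∀ g → oneMinusX ⊛ g ≗ [1-x]· g
oneMinusX-⊛ g zero    = trans (+-identityˡ _) (*-identityˡ (g 0))
oneMinusX-⊛ g (suc n) = begin
  (oneMinusX ⊛ g) (suc n)
    ≡⟨ ⊛-suc oneMinusX g n ⟩
  + 1 * g (suc n) + (tail oneMinusX ⊛ g) n
    ≡⟨ cong (_+_ (+ 1 * g (suc n))) (⊛-constant (tail oneMinusX) g (λ _ → refl) n) ⟩
  + 1 * g (suc n) + (- + 1) * g n
    ≡⟨ difference (g (suc n)) (g n) ⟩
  g (suc n) - g n ∎
  where
  difference : ∀ a b → + 1 * a + (- + 1) * b ≡ a - b
  difference = solve-∀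

oneMinusX²-⊛ : ∀ g → oneMinusX² ⊛ g ≗ [1-x²]· g
oneMinusX²-⊛ g zero          = trans (+-identityˡ _) (*-identityˡ (g 0))
oneMinusX²-⊛ g (suc zero)    = base (g 1) (g 0)
  where
  base : ∀ a b → + 0 + + 1 * a + + 0 * b ≡ a
  base = solve-∀
oneMinusX²-⊛ g (suc (suc n)) = begin
  (oneMinusX² ⊛ g) (suc (suc n))
    ≡⟨ ⊛-suc oneMinusX² g (suc n) ⟩
  + 1 * g (suc (suc n)) + (tail oneMinusX² ⊛ g) (suc n)
    ≡⟨ cong (_+_ (+ 1 * g (suc (suc n)))) (⊛-suc (tail oneMinusX²) g n) ⟩
  + 1 * g (suc (suc n)) + (+ 0 * g (suc n) + (tail (tail oneMinusX²) ⊛ g) n)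
    ≡⟨ cong (λ z → + 1 * g (suc (suc n)) + (+ 0 * g (suc n) + z))
            (⊛-constant (tail (tail oneMinusX²)) g (λ _ → refl) n) ⟩
  + 1 * g (suc (suc n)) + (+ 0 * g (suc n) + (- + 1) * g n)
    ≡⟨ difference (g (suc (suc n))) (g (suc n)) (g n) ⟩
  g (suc (suc n)) - g n ∎
  where
  difference : ∀ a b c → + 1 * a + (+ 0 * b + (- + 1) * c) ≡ a - c
  difference = solve-∀

oneMinusX^2-⊛ : ∀ g → (oneMinusX ^ˢ 2) ⊛ g ≗ [1-x]· [1-x]· g
oneMinusX^2-⊛ g n = begin
  ((oneMinusX ⊛ (oneMinusX ⊛ one)) ⊛ g) n    ≡⟨ ⊛-assoc oneMinusX (oneMinusX ⊛ one) g n ⟩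
  (oneMinusX ⊛ ((oneMinusX ⊛ one) ⊛ g)) n    ≡⟨ oneMinusX-⊛ ((oneMinusX ⊛ one) ⊛ g) n ⟩
  ([1-x]· ((oneMinusX ⊛ one) ⊛ g)) n         ≡⟨ [1-x]-cong inner n ⟩
  ([1-x]· [1-x]· g) n                        ∎
  where
  inner : (oneMinusX ⊛ one) ⊛ g ≗ [1-x]· g
  inner m = trans (⊛-assoc oneMinusX one g m)
                  (trans (oneMinusX-⊛ (one ⊛ g) m) ([1-x]-cong (⊛-identityˡ g) m))

[1+x]-injective : ∀ {g h} → [1+x]· g ≗ [1+x]· h → g ≗ h
[1+x]-injective eq zero    = eq 0
[1+x]-injective {g} {h} eq (suc n) = begin
  g (suc n)                 ≡⟨ cancel (g (suc n)) (g n) ⟩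
  (g (suc n) + g n) - g n   ≡⟨ cong₂ _-_ (eq (suc n)) ([1+x]-injective eq n) ⟩
  (h (suc n) + h n) - h n   ≡⟨ sym (cancel (h (suc n)) (h n)) ⟩
  h (suc n)                 ∎
  where
  cancel : ∀ a b → a ≡ (a + b) - b
  cancel = solve-∀

[1+x]-[1-x] : ∀ g → [1+x]· ([1-x]· g) ≗ [1-x²]· g
[1+x]-[1-x] g zero          = refl
[1+x]-[1-x] g (suc zero)    = telescope (g 1) (g 0)
  where
  telescope : ∀ a b → a - b + b ≡ a
  telescope = solve-∀
[1+x]-[1-x] g (suc (suc n)) = telescope (g (suc (suc n))) (g (suc n)) (g n)
  where
  telescope : ∀ a b c → a - b + (b - c) ≡ a - c
  telescope = solve-∀

[1-x]-[1+x] : ∀ g → [1-x]· ([1+x]· g) ≗ [1-x²]· g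
[1-x]-[1+x] g zero          = refl
[1-x]-[1+x] g (suc zero)    = telescope (g 1) (g 0)
  where
  telescope : ∀ a b → a + b - b ≡ a
  telescope = solve-∀
[1-x]-[1+x] g (suc (suc n)) = telescope (g (suc (suc n))) (g (suc n)) (g n)
  where
  telescope : ∀ a b c → a + b - (b + c) ≡ a - c
  telescope = solve-∀

[1+x]²[1-x]² : ∀ g → [1+x]· [1+x]· [1-x]· [1-x]· g ≗ [1-x²]· [1-x²]· g
[1+x]²[1-x]² g n = begin
  ([1+x]· [1+x]· [1-x]· [1-x]· g) n         ≡⟨ [1+x]-cong ([1+x]-[1-x] ([1-x]· g)) n ⟩
  ([1+x]· [1-x²]· [1-x]· g) n               ≡⟨ [1+x]-cong (λ m → sym ([1-x]-[1+x] ([1-x]· g) m)) n ⟩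
  ([1+x]· [1-x]· [1+x]· [1-x]· g) n         ≡⟨ [1+x]-cong ([1-x]-cong ([1+x]-[1-x] g)) n ⟩
  ([1+x]· [1-x]· [1-x²]· g) n               ≡⟨ [1+x]-[1-x] ([1-x²]· g) n ⟩
  ([1-x²]· [1-x²]· g) n                     ∎

⊛-[1-x] : ∀ f g → f ⊛ [1-x]· g ≗ [1-x]· (f ⊛ g)
⊛-[1-x] f g zero          = refl
⊛-[1-x] f g (suc zero)    = begin
  (f ⊛ [1-x]· g) 1                             ≡⟨ ⊛-suc f ([1-x]· g) 0 ⟩
  f 0 * (g 1 - g 0) + (tail f ⊛ [1-x]· g) 0    ≡⟨ cong (_+_ (f 0 * (g 1 - g 0))) (⊛-[1-x] (tail f) g 0) ⟩
  f 0 * (g 1 - g 0) + (tail f ⊛ g) 0           ≡⟨ rearrange (f 0) (g 1) (g 0) ((tail f ⊛ g) 0) ⟩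
  f 0 * g 1 + (tail f ⊛ g) 0 - (+ 0 + f 0 * g 0) ≡⟨ cong (_- (f ⊛ g) 0) (sym (⊛-suc f g 0)) ⟩
  (f ⊛ g) 1 - (f ⊛ g) 0                        ∎
  where
  rearrange : ∀ a b c t → a * (b - c) + t ≡ a * b + t - (+ 0 + a * c)
  rearrange = solve-∀
⊛-[1-x] f g (suc (suc n)) = begin
  (f ⊛ [1-x]· g) (suc (suc n))
    ≡⟨ ⊛-suc f ([1-x]· g) (suc n) ⟩
  f 0 * (g (suc (suc n)) - g (suc n)) + (tail f ⊛ [1-x]· g) (suc n)
    ≡⟨ cong (_+_ (f 0 * (g (suc (suc n)) - g (suc n)))) (⊛-[1-x] (tail f) g (suc n)) ⟩
  f 0 * (g (suc (suc n)) - g (suc n)) + ((tail f ⊛ g) (suc n) - (tail f ⊛ g) n)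
    ≡⟨ rearrange (f 0) (g (suc (suc n))) (g (suc n)) ((tail f ⊛ g) (suc n)) ((tail f ⊛ g) n) ⟩
  (f 0 * g (suc (suc n)) + (tail f ⊛ g) (suc n)) - (f 0 * g (suc n) + (tail f ⊛ g) n)
    ≡⟨ sym (cong₂ _-_ (⊛-suc f g (suc n)) (⊛-suc f g n)) ⟩
  (f ⊛ g) (suc (suc n)) - (f ⊛ g) (suc n) ∎
  where
  rearrange : ∀ a b c t s → a * (b - c) + (t - s) ≡ (a * b + t) - (a * c + s)
  rearrange = solve-∀

-- Even and odd parts

interleave : Series → Series → Series
interleave e o zero          = e 0
interleave e o (suc zero)    = o 0
interleave e o (suc (suc n)) = interleave (tail e) (tail o) n

interleave-even : ∀ e o m → interleave e o (2 ℕ.* m) ≡ e m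
interleave-even e o zero    = refl
interleave-even e o (suc m) = trans (cong (interleave e o) (ℕₚ.*-suc 2 m)) (interleave-even (tail e) (tail o) m)

interleave-odd : ∀ e o m → interleave e o (suc (2 ℕ.* m)) ≡ o m
interleave-odd e o zero    = refl
interleave-odd e o (suc m) = trans (cong (interleave e o ∘ suc) (ℕₚ.*-suc 2 m)) (interleave-odd (tail e) (tail o) m)

≗-interleave : ∀ {g} e o → (∀ m → g (2 ℕ.* m) ≡ e m) → (∀ m → g (suc (2 ℕ.* m)) ≡ o m) →
               g ≗ interleave e o
≗-interleave e o even odd zero          = even 0
≗-interleave e o even odd (suc zero)    = odd 0
≗-interleave {g} e o even odd (suc (suc n)) =
  ≗-interleave {g ∘ suc ∘ suc} (tail e) (tail o)
    (λ m → trans (cong g (sym (ℕₚ.*-suc 2 m))) (even (suc m)))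
    (λ m → trans (cong (g ∘ suc) (sym (ℕₚ.*-suc 2 m))) (odd (suc m)))
    n

interleave-cong : ∀ {e e′ o o′} → e ≗ e′ → o ≗ o′ → interleave e o ≗ interleave e′ o′
interleave-cong {e} {e′} {o} {o′} e≗e′ o≗o′ =
  ≗-interleave e′ o′ (λ m → trans (interleave-even e o m) (e≗e′ m))
                     (λ m → trans (interleave-odd e o m) (o≗o′ m))

[1-x²]-interleave : ∀ e o → [1-x²]· interleave e o ≗ interleave ([1-x]· e) ([1-x]· o)
[1-x²]-interleave e o = ≗-interleave ([1-x]· e) ([1-x]· o) even odd
  where
  even : ∀ m → ([1-x²]· interleave e o) (2 ℕ.* m) ≡ ([1-x]· e) m
  even zero    = refl
  even (suc m) = trans (cong ([1-x²]· interleave e o) (ℕₚ.*-suc 2 m))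
                       (cong₂ _-_ (interleave-even (tail e) (tail o) m) (interleave-even e o m))
  odd : ∀ m → ([1-x²]· interleave e o) (suc (2 ℕ.* m)) ≡ ([1-x]· o) m
  odd zero    = refl
  odd (suc m) = trans (cong ([1-x²]· interleave e o ∘ suc) (ℕₚ.*-suc 2 m))
                      (cong₂ _-_ (interleave-odd (tail e) (tail o) m) (interleave-odd e o m))

[1+x]-interleave : ∀ e o → [1+x]· interleave e o ≗ interleave (e ⊕ x· o) (o ⊕ e)
[1+x]-interleave e o = ≗-interleave (e ⊕ x· o) (o ⊕ e) even odd
  where
  even : ∀ m → ([1+x]· interleave e o) (2 ℕ.* m) ≡ e m + (x· o) m
  even zero    = sym (+-identityʳ (e 0))
  even (suc m) = trans (cong ([1+x]· interleave e o) (ℕₚ.*-suc 2 m))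
                       (cong₂ _+_ (interleave-even (tail e) (tail o) m) (interleave-odd e o m))
  odd : ∀ m → ([1+x]· interleave e o) (suc (2 ℕ.* m)) ≡ o m + e m
  odd m = cong₂ _+_ (interleave-odd e o m) (interleave-even e o m)

-- The series B N = (1 - x)^-(N+1)

C-pascal : ∀ n k → + (suc n C suc k) ≡ + (n C k) + + (n C suc k)
C-pascal n k = trans (cong +_ (sym (nCk+nC[k+1]≡[n+1]C[k+1] n k))) (pos-+ (n C k) (n C suc k))

B : ℕ → Series
B N m = + ((m ℕ.+ N) C N)

B-zero : ∀ N → B N 0 ≡ + 1
B-zero N = cong +_ (nCn≡1 N)

B-pascal : ∀ a m → B (suc a) (suc m) ≡ B a (suc m) + B (suc a) m
B-pascal a m = trans (C-pascal (m ℕ.+ suc a) a) (cong (λ n → + (n C a) + B (suc a) m) (ℕₚ.+-suc m a))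

[1-x]-B : ∀ N → [1-x]· B (suc N) ≗ B N
[1-x]-B N zero    = trans (B-zero (suc N)) (sym (B-zero N))
[1-x]-B N (suc m) = trans (cong (_- B (suc N) m) (B-pascal N m)) (cancel (B N (suc m)) (B (suc N) m))
  where
  cancel : ∀ a b → a + b - b ≡ a
  cancel = solve-∀

[1-x]-⊛B : ∀ c N → [1-x]· (c ⊛ B (suc N)) ≗ c ⊛ B N
[1-x]-⊛B c N n = trans (sym (⊛-[1-x] c (B (suc N)) n)) (⊛-congʳ c ([1-x]-B N) n)

[1-x]-⊛B₀ : ∀ c → [1-x]· (c ⊛ B 0) ≗ c
[1-x]-⊛B₀ c n = begin
  ([1-x]· (c ⊛ B 0)) n  ≡⟨ sym (⊛-[1-x] c (B 0) n) ⟩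
  (c ⊛ [1-x]· B 0) n    ≡⟨ ⊛-congʳ c [1-x]-B₀ n ⟩
  (c ⊛ one) n           ≡⟨ ⊛-identityʳ c n ⟩
  c n                   ∎
  where
  [1-x]-B₀ : [1-x]· B 0 ≗ one
  [1-x]-B₀ zero    = refl
  [1-x]-B₀ (suc m) = refl

⊛B-suc : ∀ c N m → (c ⊛ B (suc N)) (suc m) ≡ (c ⊛ B (suc N)) m + (c ⊛ B N) (suc m)
⊛B-suc c N m = trans (split ((c ⊛ B (suc N)) (suc m)) ((c ⊛ B (suc N)) m))
                     (cong (_+_ ((c ⊛ B (suc N)) m)) ([1-x]-⊛B c N (suc m)))
  where
  split : ∀ a b → a ≡ b + (a - b)
  split = solve-∀

⊛B-zero : ∀ c N → (c ⊛ B N) 0 ≡ c 0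
⊛B-zero c N = trans (+-identityˡ _) (trans (cong (c 0 *_) (B-zero N)) (*-identityʳ (c 0)))

⊛B-unit : ∀ c N → c 0 ≡ + 1 → (∀ j → c (suc j) ≡ + 0) → c ⊛ B N ≗ B N
⊛B-unit c N c₀≡1 c₊≡0 m =
  trans (⊛-constant c (B N) c₊≡0 m) (trans (cong (_* B N m) c₀≡1) (*-identityˡ (B N m)))

⊛B-suc-split : ∀ {c} c₁ c₂ N m → c ≗ c₁ ⊕ c₂ →
               (c ⊛ B (suc N)) (suc m) ≡ (c ⊛ B (suc N)) m + ((c₁ ⊛ B N) (suc m) + (c₂ ⊛ B N) (suc m))
⊛B-suc-split {c} c₁ c₂ N m c≗c₁⊕c₂ =
  trans (⊛B-suc c N m)
        (cong (_+_ ((c ⊛ B (suc N)) m))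
              (trans (⊛-congˡ (B N) c≗c₁⊕c₂ (suc m)) (⊕-⊛ c₁ c₂ (B N) (suc m))))

CC : ℕ → ℕ → Series
CC a b j = + (a C j) * + (b C j)

CC⁺ : ℕ → ℕ → Series
CC⁺ a b j = + (a C j) * + (suc b C suc j)

expand : ∀ u₁ u₀ v₁ v₀ → (u₁ + u₀) * (v₁ + v₀) ≡ u₀ * v₀ + ((u₁ + u₀) * v₁ + u₁ * v₀)
expand = solve-∀

-- Both sides satisfy Pascal's recurrence in m. Expanding B (suc a) (suc m) * B (suc b) (suc m) by it
-- produces the cross term B a (suc m) * B (suc b) m, hence the simultaneous shifted identity.
mutual
  B-product : ∀ a b m → B a m * B b m ≡ (CC a b ⊛ B (a ℕ.+ b)) m
  B-product zero b m = trans (*-identityˡ (B b m)) (sym (⊛B-unit (CC 0 b) b refl (λ _ → refl) m))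
  B-product (suc a) zero m = begin
    B (suc a) m * + 1
      ≡⟨ *-identityʳ (B (suc a) m) ⟩
    B (suc a) m
      ≡⟨ cong (λ N → B N m) (sym (ℕₚ.+-identityʳ (suc a))) ⟩
    B (suc a ℕ.+ 0) m
      ≡⟨ sym (⊛B-unit (CC (suc a) 0) (suc a ℕ.+ 0) refl (λ j → *-zeroʳ (+ (suc a C suc j))) m) ⟩
    (CC (suc a) 0 ⊛ B (suc a ℕ.+ 0)) m ∎
  B-product (suc a) (suc b) zero = begin
    B (suc a) 0 * B (suc b) 0         ≡⟨ cong₂ _*_ (B-zero (suc a)) (B-zero (suc b)) ⟩
    + 1                               ≡⟨ sym (⊛B-zero (CC (suc a) (suc b)) (suc a ℕ.+ suc b)) ⟩
    (CC (suc a) (suc b) ⊛ B (suc a ℕ.+ suc b)) 0 ∎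
  B-product (suc a) (suc b) (suc m) = begin
    B (suc a) (suc m) * B (suc b) (suc m)
      ≡⟨ cong₂ _*_ (B-pascal a m) (B-pascal b m) ⟩
    (u₁ + u₀) * (v₁ + v₀)
      ≡⟨ expand u₁ u₀ v₁ v₀ ⟩
    u₀ * v₀ + ((u₁ + u₀) * v₁ + u₁ * v₀)
      ≡⟨ cong₂ _+_ (B-product (suc a) (suc b) m) (cong₂ _+_ left right) ⟩
    (c ⊛ B (suc N)) m + ((CC (suc a) b ⊛ B N) (suc m) + (x· CC⁺ b a ⊛ B N) (suc m))
      ≡⟨ sym (⊛B-suc-split (CC (suc a) b) (x· CC⁺ b a) N m split) ⟩
    (c ⊛ B (suc N)) (suc m) ∎
    where
    c = CC (suc a) (suc b)
    N = a ℕ.+ suc b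
    u₁ = B a (suc m)
    u₀ = B (suc a) m
    v₁ = B b (suc m)
    v₀ = B (suc b) m
    left : (u₁ + u₀) * v₁ ≡ (CC (suc a) b ⊛ B N) (suc m)
    left = begin
      (u₁ + u₀) * v₁
        ≡⟨ cong (_* v₁) (sym (B-pascal a m)) ⟩
      B (suc a) (suc m) * v₁
        ≡⟨ B-product (suc a) b (suc m) ⟩
      (CC (suc a) b ⊛ B (suc a ℕ.+ b)) (suc m)
        ≡⟨ cong (λ M → (CC (suc a) b ⊛ B M) (suc m)) (sym (ℕₚ.+-suc a b)) ⟩
      (CC (suc a) b ⊛ B N) (suc m) ∎
    right : u₁ * v₀ ≡ (x· CC⁺ b a ⊛ B N) (suc m)
    right = begin
      u₁ * v₀                            ≡⟨ *-comm u₁ v₀ ⟩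
      v₀ * u₁                            ≡⟨ B-product⁺ b a m ⟩
      (CC⁺ b a ⊛ B (suc b ℕ.+ a)) m      ≡⟨ cong (λ M → (CC⁺ b a ⊛ B M) m) (ℕₚ.+-comm (suc b) a) ⟩
      (CC⁺ b a ⊛ B N) m                  ≡⟨ sym (x·-⊛ (CC⁺ b a) (B N) m) ⟩
      (x· CC⁺ b a ⊛ B N) (suc m)         ∎
    split : c ≗ CC (suc a) b ⊕ x· CC⁺ b a
    split zero    = sym (+-identityʳ _)
    split (suc j) = trans (cong (+ (suc a C suc j) *_) (C-pascal b j))
                          (distrib (+ (suc a C suc j)) (+ (b C j)) (+ (b C suc j)))
      where
      distrib : ∀ x y z → x * (y + z) ≡ x * z + y * x
      distrib = solve-∀

  B-product⁺ : ∀ a b m → B (suc a) m * B b (suc m) ≡ (CC⁺ a b ⊛ B (suc a ℕ.+ b)) m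
  B-product⁺ a zero m = begin
    B (suc a) m * + 1
      ≡⟨ *-identityʳ (B (suc a) m) ⟩
    B (suc a) m
      ≡⟨ cong (λ N → B N m) (sym (ℕₚ.+-identityʳ (suc a))) ⟩
    B (suc a ℕ.+ 0) m
      ≡⟨ sym (⊛B-unit (CC⁺ a 0) (suc a ℕ.+ 0) refl (λ j → *-zeroʳ (+ (a C suc j))) m) ⟩
    (CC⁺ a 0 ⊛ B (suc a ℕ.+ 0)) m ∎
  B-product⁺ a (suc b) zero = begin
    B (suc a) 0 * B (suc b) 1                  ≡⟨ cong₂ _*_ (B-zero (suc a)) (cong +_ symmetry) ⟩
    + 1 * + (suc (suc b) C 1)                  ≡⟨ sym (⊛B-zero (CC⁺ a (suc b)) (suc a ℕ.+ suc b)) ⟩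
    (CC⁺ a (suc b) ⊛ B (suc a ℕ.+ suc b)) 0    ∎
    where
    symmetry : suc (suc b) C suc b ≡ suc (suc b) C 1
    symmetry = trans (nCk≡nC[n∸k] (ℕₚ.n≤1+n (suc b))) (cong (suc (suc b) C_) (ℕₚ.m+n∸n≡m 1 b))
  B-product⁺ a (suc b) (suc m) = begin
    B (suc a) (suc m) * B (suc b) (suc (suc m))
      ≡⟨ cong₂ _*_ (B-pascal a m) (B-pascal b (suc m)) ⟩
    (u₁ + u₀) * (v₁ + v₀)
      ≡⟨ expand u₁ u₀ v₁ v₀ ⟩
    u₀ * v₀ + ((u₁ + u₀) * v₁ + u₁ * v₀)
      ≡⟨ cong₂ _+_ (B-product⁺ a (suc b) m) (cong₂ _+_ left right) ⟩
    (c ⊛ B (suc N)) m + ((CC⁺ a b ⊛ B N) (suc m) + (CC a (suc b) ⊛ B N) (suc m))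
      ≡⟨ sym (⊛B-suc-split (CC⁺ a b) (CC a (suc b)) N m split) ⟩
    (c ⊛ B (suc N)) (suc m) ∎
    where
    c = CC⁺ a (suc b)
    N = a ℕ.+ suc b
    u₁ = B a (suc m)
    u₀ = B (suc a) m
    v₁ = B b (suc (suc m))
    v₀ = B (suc b) (suc m)
    left : (u₁ + u₀) * v₁ ≡ (CC⁺ a b ⊛ B N) (suc m)
    left = begin
      (u₁ + u₀) * v₁
        ≡⟨ cong (_* v₁) (sym (B-pascal a m)) ⟩
      B (suc a) (suc m) * v₁
        ≡⟨ B-product⁺ a b (suc m) ⟩
      (CC⁺ a b ⊛ B (suc a ℕ.+ b)) (suc m)
        ≡⟨ cong (λ M → (CC⁺ a b ⊛ B M) (suc m)) (sym (ℕₚ.+-suc a b)) ⟩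
      (CC⁺ a b ⊛ B N) (suc m) ∎
    right : u₁ * v₀ ≡ (CC a (suc b) ⊛ B N) (suc m)
    right = B-product a (suc b) (suc m)
    split : c ≗ CC⁺ a b ⊕ CC a (suc b)
    split j = trans (cong (+ (a C j) *_) (C-pascal (suc b) j))
                    (distrib (+ (a C j)) (+ (suc b C j)) (+ (suc b C suc j)))
      where
      distrib : ∀ x y z → x * (y + z) ≡ x * z + x * y
      distrib = solve-∀

[1-x²]-interleave-⊛B : ∀ c d N →
                       [1-x²]· interleave (c ⊛ B (suc N)) (d ⊛ B (suc N)) ≗ interleave (c ⊛ B N) (d ⊛ B N)
[1-x²]-interleave-⊛B c d N n =
  trans ([1-x²]-interleave (c ⊛ B (suc N)) (d ⊛ B (suc N)) n)
        (interleave-cong ([1-x]-⊛B c N) ([1-x]-⊛B d N) n)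

[1-x²]-interleave-⊛B₀ : ∀ c d → [1-x²]· interleave (c ⊛ B 0) (d ⊛ B 0) ≗ interleave c d
[1-x²]-interleave-⊛B₀ c d n =
  trans ([1-x²]-interleave (c ⊛ B 0) (d ⊛ B 0) n) (interleave-cong ([1-x]-⊛B₀ c) ([1-x]-⊛B₀ d) n)

oneMinusX²^ˢ-lowers : (G : ℕ → Series) → (∀ N → [1-x²]· G (suc N) ≗ G N) →
                      ∀ j N → (oneMinusX² ^ˢ j) ⊛ G (j ℕ.+ N) ≗ G N
oneMinusX²^ˢ-lowers G lowers zero    N = ⊛-identityˡ (G N)
oneMinusX²^ˢ-lowers G lowers (suc j) N n = begin
  ((oneMinusX² ⊛ (oneMinusX² ^ˢ j)) ⊛ G (suc j ℕ.+ N)) n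
    ≡⟨ ⊛-assoc oneMinusX² (oneMinusX² ^ˢ j) (G (suc j ℕ.+ N)) n ⟩
  (oneMinusX² ⊛ ((oneMinusX² ^ˢ j) ⊛ G (suc j ℕ.+ N))) n
    ≡⟨ oneMinusX²-⊛ ((oneMinusX² ^ˢ j) ⊛ G (suc j ℕ.+ N)) n ⟩
  ([1-x²]· ((oneMinusX² ^ˢ j) ⊛ G (suc (j ℕ.+ N)))) n
    ≡⟨ [1-x²]-cong lowered n ⟩
  ([1-x²]· G (suc N)) n
    ≡⟨ lowers N n ⟩
  G N n ∎
  where
  lowered : (oneMinusX² ^ˢ j) ⊛ G (suc (j ℕ.+ N)) ≗ G (suc N)
  lowered n = trans (cong (λ M → ((oneMinusX² ^ˢ j) ⊛ G M) n) (sym (ℕₚ.+-suc j N)))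
                    (oneMinusX²^ˢ-lowers G lowers j (suc N) n)

half-double : ∀ m → 2 ℕ.* m / 2 ≡ m
half-double m = trans (cong (_/ 2) (ℕₚ.*-comm 2 m)) (m*n/n≡m m 2)

half-suc-double : ∀ m → suc (2 ℕ.* m) / 2 ≡ m
half-suc-double m = trans (+-distrib-/-∣ʳ 1 (divides m (ℕₚ.*-comm 2 m))) (half-double m)

F-even : ∀ k m → F k (2 ℕ.* m) ≡ B k m * B k m
F-even k m = begin
  + ((((2 ℕ.* m ℕ.+ 2 ℕ.* k) / 2) C k) ℕ.* (((2 ℕ.* m ℕ.+ 1 ℕ.+ 2 ℕ.* k) / 2) C k))
    ≡⟨ cong₂ (λ u v → + (((u / 2) C k) ℕ.* ((v / 2) C k))) (sym (ℕₚ.*-distribˡ-+ 2 m k)) shape ⟩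
  + (((2 ℕ.* (m ℕ.+ k) / 2) C k) ℕ.* ((suc (2 ℕ.* (m ℕ.+ k)) / 2) C k))
    ≡⟨ cong₂ (λ u v → + ((u C k) ℕ.* (v C k))) (half-double (m ℕ.+ k)) (half-suc-double (m ℕ.+ k)) ⟩
  + (((m ℕ.+ k) C k) ℕ.* ((m ℕ.+ k) C k))
    ≡⟨ pos-* ((m ℕ.+ k) C k) ((m ℕ.+ k) C k) ⟩
  B k m * B k m ∎
  where
  shape : 2 ℕ.* m ℕ.+ 1 ℕ.+ 2 ℕ.* k ≡ suc (2 ℕ.* (m ℕ.+ k))
  shape = ℕ-solve (m ∷ k ∷ [])

F-odd : ∀ k m → F k (suc (2 ℕ.* m)) ≡ B k m * B k (suc m)
F-odd k m = begin
  + ((((suc (2 ℕ.* m) ℕ.+ 2 ℕ.* k) / 2) C k) ℕ.* (((suc (2 ℕ.* m) ℕ.+ 1 ℕ.+ 2 ℕ.* k) / 2) C k))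
    ≡⟨ cong₂ (λ u v → + (((u / 2) C k) ℕ.* ((v / 2) C k))) (cong suc (sym (ℕₚ.*-distribˡ-+ 2 m k))) shape ⟩
  + (((suc (2 ℕ.* (m ℕ.+ k)) / 2) C k) ℕ.* ((2 ℕ.* (suc m ℕ.+ k) / 2) C k))
    ≡⟨ cong₂ (λ u v → + ((u C k) ℕ.* (v C k))) (half-suc-double (m ℕ.+ k)) (half-double (suc m ℕ.+ k)) ⟩
  + (((m ℕ.+ k) C k) ℕ.* ((suc m ℕ.+ k) C k))
    ≡⟨ pos-* ((m ℕ.+ k) C k) ((suc m ℕ.+ k) C k) ⟩
  B k m * B k (suc m) ∎
  where
  shape : suc (2 ℕ.* m) ℕ.+ 1 ℕ.+ 2 ℕ.* k ≡ 2 ℕ.* (suc m ℕ.+ k)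
  shape = ℕ-solve (m ∷ k ∷ [])

F-interleave : ∀ k₁ → let k = suc k₁ in F k ≗ interleave (CC k k ⊛ B (k ℕ.+ k)) (CC⁺ k₁ k ⊛ B (k ℕ.+ k))
F-interleave k₁ = ≗-interleave _ _ (λ m → trans (F-even (suc k₁) m) (B-product (suc k₁) (suc k₁) m))
                                   (λ m → trans (F-odd (suc k₁) m) (B-product⁺ k₁ (suc k₁) m))

mono-≡ : ∀ c {e n} → n ≡ e → mono c e n ≡ c
mono-≡ c {e} {n} n≡e with n ℕ.≟ e
... | yes _   = refl
... | no n≢e  = contradiction n≡e n≢e

mono-≢ : ∀ c {e n} → n ≢ e → mono c e n ≡ + 0
mono-≢ c {e} {n} n≢e with n ℕ.≟ e
... | yes n≡e = contradiction n≡e n≢e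
... | no _    = refl

sumBelow-single : ∀ N (f : ℕ → ℤ) i₀ → (∀ i → i ≢ i₀ → f i ≡ + 0) → (N ≤ i₀ → f i₀ ≡ + 0) →
                  sumBelow N f ≡ f i₀
sumBelow-single zero    f i₀ off outside = sym (outside z≤n)
sumBelow-single (suc N) f i₀ off outside with N ℕ.≟ i₀
... | yes refl = trans (cong (_+ f N) (sumBelow-zero N (λ i i<N → off i (ℕₚ.<⇒≢ i<N)))) (+-identityˡ (f N))
... | no N≢i₀  =
  trans (cong₂ _+_ (sumBelow-single N f i₀ off (λ N≤i₀ → outside (ℕₚ.≤∧≢⇒< N≤i₀ N≢i₀))) (off N N≢i₀))
        (+-identityʳ (f i₀))

odd-exponent : ∀ ℓ → 2 ℕ.* suc ℓ ∸ 1 ≡ suc (2 ℕ.* ℓ)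
odd-exponent ℓ = cong (_∸ 1) (ℕₚ.*-suc 2 ℓ)

r-even : ∀ j m → r j (2 ℕ.* m) ≡ + (j C m) * + (j C m)
r-even j m = begin
  evenTerms + oddTerms            ≡⟨ cong₂ _+_ evenTerms≡ oddTerms≡0 ⟩
  + ((j C m) ℕ.* (j C m)) + + 0 ≡⟨ +-identityʳ _ ⟩
  + ((j C m) ℕ.* (j C m))       ≡⟨ pos-* (j C m) (j C m) ⟩
  + (j C m) * + (j C m)         ∎
  where
  evenTerms = sumBelow (suc j) (λ ℓ → mono (+ ((j C ℓ) ℕ.* (j C ℓ))) (2 ℕ.* ℓ) (2 ℕ.* m))
  oddTerms  = sumBelow j (λ ℓ → mono (+ ((j C suc ℓ) ℕ.* (j C ℓ))) (2 ℕ.* suc ℓ ∸ 1) (2 ℕ.* m))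
  evenTerms≡ : evenTerms ≡ + ((j C m) ℕ.* (j C m))
  evenTerms≡ = trans (sumBelow-single (suc j) _ m off outside) (mono-≡ _ refl)
    where
    off : ∀ ℓ → ℓ ≢ m → mono (+ ((j C ℓ) ℕ.* (j C ℓ))) (2 ℕ.* ℓ) (2 ℕ.* m) ≡ + 0
    off ℓ ℓ≢m = mono-≢ _ (λ eq → ℓ≢m (sym (ℕₚ.*-cancelˡ-≡ m ℓ 2 eq)))
    outside : suc j ≤ m → mono (+ ((j C m) ℕ.* (j C m))) (2 ℕ.* m) (2 ℕ.* m) ≡ + 0
    outside j<m = trans (mono-≡ _ refl) (cong (λ c → + (c ℕ.* c)) (k>n⇒nCk≡0 j<m))
  oddTerms≡0 : oddTerms ≡ + 0
  oddTerms≡0 = sumBelow-zero j (λ ℓ _ → mono-≢ _ (λ eq → ℕₚ.even≢odd m ℓ (trans eq (odd-exponent ℓ))))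

r-odd : ∀ j m → r j (suc (2 ℕ.* m)) ≡ + (j C suc m) * + (j C m)
r-odd j m = begin
  evenTerms + oddTerms                   ≡⟨ cong₂ _+_ evenTerms≡0 oddTerms≡ ⟩
  + 0 + + ((j C suc m) ℕ.* (j C m))    ≡⟨ +-identityˡ _ ⟩
  + ((j C suc m) ℕ.* (j C m))          ≡⟨ pos-* (j C suc m) (j C m) ⟩
  + (j C suc m) * + (j C m)            ∎
  where
  evenTerms = sumBelow (suc j) (λ ℓ → mono (+ ((j C ℓ) ℕ.* (j C ℓ))) (2 ℕ.* ℓ) (suc (2 ℕ.* m)))
  oddTerms  = sumBelow j (λ ℓ → mono (+ ((j C suc ℓ) ℕ.* (j C ℓ))) (2 ℕ.* suc ℓ ∸ 1) (suc (2 ℕ.* m)))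
  evenTerms≡0 : evenTerms ≡ + 0
  evenTerms≡0 = sumBelow-zero (suc j) (λ ℓ _ → mono-≢ _ (λ eq → ℕₚ.even≢odd ℓ m (sym eq)))
  oddTerms≡ : oddTerms ≡ + ((j C suc m) ℕ.* (j C m))
  oddTerms≡ = trans (sumBelow-single j _ m off outside) (mono-≡ _ (sym (odd-exponent m)))
    where
    off : ∀ ℓ → ℓ ≢ m → mono (+ ((j C suc ℓ) ℕ.* (j C ℓ))) (2 ℕ.* suc ℓ ∸ 1) (suc (2 ℕ.* m)) ≡ + 0
    off ℓ ℓ≢m = mono-≢ _ (λ eq → ℓ≢m (sym (ℕₚ.*-cancelˡ-≡ m ℓ 2 (ℕₚ.suc-injective (trans eq (odd-exponent ℓ))))))
    outside : j ≤ m → mono (+ ((j C suc m) ℕ.* (j C m))) (2 ℕ.* suc m ∸ 1) (suc (2 ℕ.* m)) ≡ + 0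
    outside j≤m = trans (mono-≡ _ (sym (odd-exponent m))) (cong (λ c → + (c ℕ.* (j C m))) (k>n⇒nCk≡0 (s≤s j≤m)))

r-interleave : ∀ j → r j ≗ interleave (λ m → + (j C m) * + (j C m)) (λ m → + (j C suc m) * + (j C m))
r-interleave j = ≗-interleave _ _ (r-even j) (r-odd j)

[1+x]²-r : ∀ j → [1+x]· [1+x]· r j ≗ interleave (CC (suc j) (suc j)) (CC⁺ j (suc j))
[1+x]²-r j n = begin
  ([1+x]· [1+x]· r j) n
    ≡⟨ [1+x]-cong ([1+x]-cong (r-interleave j)) n ⟩
  ([1+x]· [1+x]· interleave e o) n
    ≡⟨ [1+x]-cong ([1+x]-interleave e o) n ⟩
  ([1+x]· interleave (e ⊕ x· o) (o ⊕ e)) n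
    ≡⟨ [1+x]-interleave (e ⊕ x· o) (o ⊕ e) n ⟩
  interleave ((e ⊕ x· o) ⊕ x· (o ⊕ e)) ((o ⊕ e) ⊕ (e ⊕ x· o)) n
    ≡⟨ interleave-cong evens odds n ⟩
  interleave (CC (suc j) (suc j)) (CC⁺ j (suc j)) n ∎
  where
  b e o : Series
  b m = + (j C m)
  e m = b m * b m
  o m = b (suc m) * b m
  evens : (e ⊕ x· o) ⊕ x· (o ⊕ e) ≗ CC (suc j) (suc j)
  evens zero    = refl
  evens (suc m) = trans (square (b m) (b (suc m))) (cong (λ c → c * c) (sym (C-pascal j m)))
    where
    square : ∀ x y → y * y + y * x + (y * x + x * x) ≡ (x + y) * (x + y)
    square = solve-∀
  odds : (o ⊕ e) ⊕ (e ⊕ x· o) ≗ CC⁺ j (suc j)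
  odds zero    = trans (base (b 1))
                       (cong (_*_ (+ 1)) (sym (trans (C-pascal (suc j) 0) (cong (_+_ (+ 1)) (C-pascal j 0)))))
    where
    base : ∀ y → y * + 1 + + 1 + (+ 1 + + 0) ≡ + 1 * (+ 1 + (+ 1 + y))
    base = solve-∀
  odds (suc m) = trans (step (b m) (b (suc m)) (b (suc (suc m))))
                       (cong (b (suc m) *_)
                             (sym (trans (C-pascal (suc j) (suc m)) (cong₂ _+_ (C-pascal j m) (C-pascal j (suc m))))))
    where
    step : ∀ x y z → z * y + y * y + (y * y + y * x) ≡ y * ((x + y) + (y + z))
    step = solve-∀

mainTheorem8 : (k : ℕ) → k ≥ 1 →
    (n : ℕ) → (((oneMinusX ^ˢ 2) ⊛ ((oneMinusX² ^ˢ (2 ℕ.* k ∸ 1)) ⊛ F k)) n) ≡ r (k ∸ 1) n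
mainTheorem8 (suc k₁) _ = [1+x]-injective ([1+x]-injective λ n → begin
  ([1+x]· [1+x]· ((oneMinusX ^ˢ 2) ⊛ H)) n  ≡⟨ [1+x]-cong ([1+x]-cong (oneMinusX^2-⊛ H)) n ⟩
  ([1+x]· [1+x]· [1-x]· [1-x]· H) n          ≡⟨ [1+x]²[1-x]² H n ⟩
  ([1-x²]· [1-x²]· H) n                      ≡⟨ [1-x²]-cong ([1-x²]-cong H≗G₁) n ⟩
  ([1-x²]· [1-x²]· G 1) n                    ≡⟨ [1-x²]-cong ([1-x²]-interleave-⊛B c d 0) n ⟩
  ([1-x²]· G 0) n                            ≡⟨ [1-x²]-interleave-⊛B₀ c d n ⟩
  interleave c d n                           ≡⟨ sym ([1+x]²-r k₁ n) ⟩
  ([1+x]· [1+x]· r k₁) n                     ∎)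
  where
  k = suc k₁
  j = 2 ℕ.* k ∸ 1
  c = CC k k
  d = CC⁺ k₁ k
  G : ℕ → Series
  G N = interleave (c ⊛ B N) (d ⊛ B N)
  H = (oneMinusX² ^ˢ j) ⊛ F k
  k+k≡j+1 : k ℕ.+ k ≡ j ℕ.+ 1
  k+k≡j+1 = trans (cong (k ℕ.+_) (sym (ℕₚ.+-identityʳ k))) (sym (ℕₚ.m∸n+n≡m (s≤s z≤n)))
  H≗G₁ : H ≗ G 1
  H≗G₁ m = begin
    ((oneMinusX² ^ˢ j) ⊛ F k) m         ≡⟨ ⊛-congʳ (oneMinusX² ^ˢ j) (F-interleave k₁) m ⟩
    ((oneMinusX² ^ˢ j) ⊛ G (k ℕ.+ k)) m ≡⟨ cong (λ N → ((oneMinusX² ^ˢ j) ⊛ G N) m) k+k≡j+1 ⟩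
    ((oneMinusX² ^ˢ j) ⊛ G (j ℕ.+ 1)) m ≡⟨ oneMinusX²^ˢ-lowers G ([1-x²]-interleave-⊛B c d) j 1 m ⟩
    G 1 m                               ∎
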